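{- For every $n\ge 2$, $f_4(n)\le \lceil\log_2 n\rceil+\lceil\log_2\log_2 n\rceil+2$.
   Context: Model 4 (adaptive, three players $A,B,C$). $X$ is an $n$-element set of distinguishable elements and Player $A$ (the adversary) chooses an unknown defective element $d\in X$. Players $B$ and $C$ may agree on a (deterministic) questioning strategy before the process starts, but cannot communicate afterwards except through the rules below. At each step Player $A$ decides which of $B$ and $C$ asks the next query; a query is a subset $Q\subseteq X$, whose answer is YES iff $d\in Q$. The player asking a query obtains no information about its answer. If the answer to a query asked by $B$ is YES, then $C$ learns the query set and that the answer was YES; similarly if the answer to a query asked by $C$ is YES, then $B$ learns the query set and that the answer was YES. If the answer is NO, the other player learns nothing (not even that a query was asked). Each player's queries may depend only on the information that player has. The goal is that at least one of $B$ and $C$ can identify $d$ (i.e. $d$ is the only element consistent with that player's information). $f_4(n)$ is the minimum $N$ such that $B$ and $C$ have a strategy guaranteeing that, whatever $d$ and whatever order of questioners $A$ chooses, the goal is reached after at most $N$ queries in total. -}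

module Defs where

open import Data.Nat using (ℕ; zero; suc; _+_)
open import Data.Nat.Logarithm using (⌈log₂_⌉)
open import Data.Fin using (Fin)
open import Data.Fin.Subset using (Subset; _∈_)
open import Data.Fin.Subset.Properties using (_∈?_)
open import Data.List using (List; []; _∷_)
open import Data.Vec using (Vec; []; _∷_)
open import Data.Maybe using (Maybe; just; nothing)
open import Data.Product using (Σ; _×_; _,_)
open import Data.Sum using (_⊎_)
open import Relation.Nullary using (yes; no)
open import Relation.Binary.PropositionalEquality using (_≡_)

data Player : Set where
  B C : Player

Query : ℕ → Set
Query n = Subset n

-- What a questioner has observed so far, most recent event first:
--   nothing  = "I asked a query (I get no information about its answer)"
--   just Q   = "the other player asked Q and the answer was YES"
-- (NO answers to the other player's queries are invisible.)
View : ℕ → Set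
View n = List (Maybe (Query n))

Strategy : ℕ → Set
Strategy n = View n → Query n

step : ∀ {n} → Strategy n → Strategy n → Fin n →
       View n × View n → Player → View n × View n
step sB sC d (vB , vC) B with d ∈? sB vB
... | yes _ = (nothing ∷ vB , just (sB vB) ∷ vC)
... | no  _ = (nothing ∷ vB , vC)
step sB sC d (vB , vC) C with d ∈? sC vC
... | yes _ = (just (sC vC) ∷ vB , nothing ∷ vC)
... | no  _ = (vB , nothing ∷ vC)

runFrom : ∀ {n k} → Strategy n → Strategy n → Fin n →
          View n × View n → Vec Player k → View n × View n
runFrom sB sC d st []       = st
runFrom sB sC d st (p ∷ ps) = runFrom sB sC d (step sB sC d st p) ps

run : ∀ {n k} → Strategy n → Strategy n → Fin n → Vec Player k → View n × View n
run sB sC d order = runFrom sB sC d ([] , []) order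

knownYes : ∀ {n} → View n → List (Query n)
knownYes []             = []
knownYes (nothing ∷ v)  = knownYes v
knownYes (just Q ∷ v)   = Q ∷ knownYes v

data ConsistentWith {n} (e : Fin n) : List (Query n) → Set where
  []  : ConsistentWith e []
  _∷_ : ∀ {Q Qs} → e ∈ Q → ConsistentWith e Qs → ConsistentWith e (Q ∷ Qs)

Identifies : ∀ {n} → Fin n → View n → Set
Identifies d v = ∀ e → ConsistentWith e (knownYes v) → e ≡ d

-- The strategy pair (sB , sC) reaches the goal within N queries in total,
-- whatever d and whatever order of questioners A chooses.
-- (Knowledge only grows, so "goal reached after at most N queries" is the
-- same as "goal holds after N queries for every order of length N".)
Solves : ∀ {n} → ℕ → Strategy n → Strategy n → Set
Solves {n} N sB sC =
  (d : Fin n) (order : Vec Player N) →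
  let (vB , vC) = run sB sC d order in Identifies d vB ⊎ Identifies d vC

-- f₄(n) ≤ N  iff  B and C have a strategy solving Model 4 within N queries.
f4≤ : ℕ → ℕ → Set
f4≤ n N = Σ (Strategy n) λ sB → Σ (Strategy n) λ sC → Solves N sB sC

-- ⌈log₂ log₂ n⌉ = ⌈log₂ ⌈log₂ n⌉⌉ (since 2^k is an integer).
bound4 : ℕ → ℕ
bound4 n = ⌈log₂ n ⌉ + ⌈log₂ ⌈log₂ n ⌉ ⌉ + 2

-- Give every element e a codeword c(e) ⊆ {0, …, m-1} such that c(d) ⊆ c(e)
-- forces d = e, and let position i stand for the query {e : i ∈ c(e)}.  B asks
-- positions 0, 1, 2, … and C asks m-1, m-2, …, each intersected with the
-- candidates the asker currently has.  A YES answer hands the other player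
-- everything the asker knew, so whoever received the last YES knows, for every
-- asked position whose query contains d, that all its candidates lie in that
-- query.  After m queries every position has been asked, so each of its
-- candidates e satisfies c(d) ⊆ c(e), i.e. e = d.
--   A code of length ⌈log₂ n⌉ + ⌈log₂ ⌈log₂ n⌉⌉ + 2 with this property is the
-- binary expansion of e followed by the binary expansion of its number of zero
-- digits: enlarging the first part decreases the number of zeros, which the
-- second part forbids.

module Submission where

open import Defs
open import Data.Nat using (ℕ; zero; suc; _+_; _*_; _∸_; _^_; _≤_; _<_; _<?_; pred; z≤n; s≤s; ⌈_/2⌉)
open import Data.Nat.Properties
open import Data.Nat.Logarithm using (⌈log₂_⌉)
open import Data.Nat.Logarithm.Core using (⌈log2⌉)
open import Data.Nat.Induction using (<-wellFounded)
open import Induction.WellFounded using (Acc; acc)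
open import Data.Fin using (Fin; toℕ)
open import Data.Fin.Properties using (toℕ-injective; toℕ<n)
open import Data.Fin.Subset using (Subset; Side; inside; outside; _∈_; _∉_; _⊆_; _∩_; ∁; ⋂; ∣_∣)
open import Data.Fin.Subset.Properties
  using (_∈?_; ∈⊤; x∈p∩q⁺; p∩q⊆p; p∩q⊆q; drop-∷-⊆; ⊆-antisym; p⊂q⇒∣p∣<∣q∣;
         ⊆-reflexive; ⊆-trans; p⊆q⇒∁p⊇∁q; ∁p⊆∁q⇒p⊇q; ∣p∣≤n)
open import Data.List using ([]; _∷_)
open import Data.Vec using (Vec; []; _∷_; _++_; lookup; tabulate; here; there)
open import Data.Vec.Properties using (lookup⇒[]=; []=⇒lookup; lookup∘tabulate)
open import Data.Maybe using (just; nothing)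
open import Data.Product using (∃-syntax; _×_; _,_; proj₁; proj₂)
open import Data.Sum using (_⊎_; inj₁; inj₂; [_,_])
import Data.Sum as Sum
open import Function using (id; _∘_)
open import Level using (0ℓ)
open import Relation.Nullary using (yes; no; contradiction)
open import Relation.Unary using (Pred; _∪_)
open import Relation.Binary.PropositionalEquality hiding ([_])

p⊆q∧∣q∣≤∣p∣⇒p≡q : ∀ {k} {p q : Subset k} → p ⊆ q → ∣ q ∣ ≤ ∣ p ∣ → p ≡ q
p⊆q∧∣q∣≤∣p∣⇒p≡q {p = p} {q} p⊆q ∣q∣≤∣p∣ = ⊆-antisym p⊆q q⊆p
  where
  q⊆p : q ⊆ p
  q⊆p {x} x∈q with x ∈? p
  ... | yes x∈p = x∈p
  ... | no  x∉p = contradiction (p⊂q⇒∣p∣<∣q∣ (p⊆q , x , x∈q , x∉p)) (≤⇒≯ ∣q∣≤∣p∣)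

++-⊆⁻ : ∀ {k j} (p q : Subset k) {p′ q′ : Subset j} →
        p ++ p′ ⊆ q ++ q′ → p ⊆ q × p′ ⊆ q′
++-⊆⁻ []      []      h = (λ ()) , h
++-⊆⁻ (s ∷ p) (t ∷ q) h with ++-⊆⁻ p q (drop-∷-⊆ h)
... | p⊆q , p′⊆q′ = head-and-tail , p′⊆q′
  where
  head-and-tail : s ∷ p ⊆ t ∷ q
  head-and-tail here with h here
  ... | here = here
  head-and-tail (there x∈p) = there (p⊆q x∈p)

-- Positions ≥ k read as outside.
lookupℕ : ∀ {k} → Subset k → ℕ → Side
lookupℕ []      _       = outside
lookupℕ (s ∷ p) zero    = s
lookupℕ (s ∷ p) (suc i) = lookupℕ p i

lookupℕ-toℕ : ∀ {k} (p : Subset k) (x : Fin k) → lookupℕ p (toℕ x) ≡ lookup p x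
lookupℕ-toℕ (s ∷ p) Fin.zero    = refl
lookupℕ-toℕ (s ∷ p) (Fin.suc x) = lookupℕ-toℕ p x

-- Binary expansions, most significant digit first

fromBits : ∀ {k} → Subset k → ℕ
fromBits []                    = 0
fromBits         (outside ∷ p) = fromBits p
fromBits {suc k} (inside  ∷ p) = 2 ^ k + fromBits p

fromBits-mono : ∀ {k} {p q : Subset k} → p ⊆ q → fromBits p ≤ fromBits q
fromBits-mono {p = []}          {[]}          _   = z≤n
fromBits-mono {p = outside ∷ p} {outside ∷ q} p⊆q = fromBits-mono (drop-∷-⊆ p⊆q)
fromBits-mono {p = outside ∷ p} {inside  ∷ q} p⊆q =
  ≤-trans (fromBits-mono (drop-∷-⊆ p⊆q)) (m≤n+m _ _)
fromBits-mono {p = inside  ∷ p} {outside ∷ q} p⊆q = contradiction (p⊆q here) λ ()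
fromBits-mono {suc k} {inside ∷ p} {inside ∷ q} p⊆q =
  +-monoʳ-≤ (2 ^ k) (fromBits-mono (drop-∷-⊆ p⊆q))

toBits : (k : ℕ) → ℕ → Subset k
toBits zero    _ = []
toBits (suc k) x with x <? 2 ^ k
... | yes _ = outside ∷ toBits k x
... | no  _ = inside  ∷ toBits k (x ∸ 2 ^ k)

fromBits-toBits : ∀ k x → x < 2 ^ k → fromBits (toBits k x) ≡ x
fromBits-toBits zero    zero    _         = refl
fromBits-toBits zero    (suc x) (s≤s ())
fromBits-toBits (suc k) x       x<2^[1+k] with x <? 2 ^ k
... | yes x<2^k = fromBits-toBits k x x<2^k
... | no  x≮2^k = begin
  2 ^ k + fromBits (toBits k (x ∸ 2 ^ k)) ≡⟨ cong (2 ^ k +_) (fromBits-toBits k _ x∸2^k<2^k) ⟩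
  2 ^ k + (x ∸ 2 ^ k)                     ≡⟨ m+[n∸m]≡n (≮⇒≥ x≮2^k) ⟩
  x                                       ∎
  where
  open ≡-Reasoning
  x∸2^k<2^k : x ∸ 2 ^ k < 2 ^ k
  x∸2^k<2^k = m<n+o⇒m∸n<o x (2 ^ k) {{m^n≢0 2 k}}
                (subst (x <_) (cong (2 ^ k +_) (+-identityʳ (2 ^ k))) x<2^[1+k])

Antichain : ∀ {n m} → (Fin n → Subset m) → Set
Antichain code = ∀ d e → code d ⊆ code e → d ≡ e

binary : ∀ {n} k → Fin n → Subset k
binary k e = toBits k (toℕ e)

binary-injective : ∀ {n} k → n ≤ 2 ^ k → (d e : Fin n) → binary k d ≡ binary k e → d ≡ e
binary-injective k n≤2^k d e eq = toℕ-injective (begin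
  toℕ d                       ≡⟨ fromBits-toBits k (toℕ d) (<-≤-trans (toℕ<n d) n≤2^k) ⟨
  fromBits (toBits k (toℕ d)) ≡⟨ cong fromBits eq ⟩
  fromBits (toBits k (toℕ e)) ≡⟨ fromBits-toBits k (toℕ e) (<-≤-trans (toℕ<n e) n≤2^k) ⟩
  toℕ e                       ∎)
  where open ≡-Reasoning

withZeroCount : ∀ {n L} K → (Fin n → Subset L) → Fin n → Subset (L + K)
withZeroCount K code e = code e ++ toBits K ∣ ∁ (code e) ∣

withZeroCount-antichain : ∀ {n L} K (code : Fin n → Subset L) → L < 2 ^ K →
                          (∀ d e → code d ≡ code e → d ≡ e) →
                          Antichain (withZeroCount K code)
withZeroCount-antichain {n} K code L<2^K code-injective d e d⊆e =
  code-injective d e (⊆-antisym cd⊆ce (∁p⊆∁q⇒p⊇q (⊆-reflexive (sym ∁ce≡∁cd))))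
  where
  zeros : Fin n → ℕ
  zeros x = ∣ ∁ (code x) ∣
  zeros<2^K : ∀ x → zeros x < 2 ^ K
  zeros<2^K x = ≤-<-trans (∣p∣≤n (∁ (code x))) L<2^K
  cd⊆ce : code d ⊆ code e
  cd⊆ce = proj₁ (++-⊆⁻ (code d) (code e) d⊆e)
  zeros-d≤zeros-e : zeros d ≤ zeros e
  zeros-d≤zeros-e = subst₂ _≤_ (fromBits-toBits K _ (zeros<2^K d)) (fromBits-toBits K _ (zeros<2^K e))
                      (fromBits-mono (proj₂ (++-⊆⁻ (code d) (code e) d⊆e)))
  ∁ce≡∁cd : ∁ (code e) ≡ ∁ (code d)
  ∁ce≡∁cd = p⊆q∧∣q∣≤∣p∣⇒p≡q (p⊆q⇒∁p⊇∁q cd⊆ce) zeros-d≤zeros-e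

n≤⌈n/2⌉+⌈n/2⌉ : ∀ n → n ≤ ⌈ n /2⌉ + ⌈ n /2⌉
n≤⌈n/2⌉+⌈n/2⌉ n = subst (_≤ ⌈ n /2⌉ + ⌈ n /2⌉) (⌊n/2⌋+⌈n/2⌉≡n n)
                    (+-monoˡ-≤ ⌈ n /2⌉ (⌊n/2⌋≤⌈n/2⌉ n))

n≤2^⌈log2⌉n : ∀ n (rec : Acc _<_ n) → n ≤ 2 ^ ⌈log2⌉ n rec
n≤2^⌈log2⌉n zero          _        = z≤n
n≤2^⌈log2⌉n (suc zero)    _        = s≤s z≤n
n≤2^⌈log2⌉n (suc (suc n)) (acc rs) = begin
  2 + n                      ≤⟨ +-monoʳ-≤ 2 (n≤⌈n/2⌉+⌈n/2⌉ n) ⟩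
  2 + (⌈ n /2⌉ + ⌈ n /2⌉)    ≡⟨ cong (λ y → 2 + (⌈ n /2⌉ + y)) (+-identityʳ ⌈ n /2⌉) ⟨
  2 + 2 * ⌈ n /2⌉            ≡⟨ *-suc 2 ⌈ n /2⌉ ⟨
  2 * suc ⌈ n /2⌉            ≤⟨ *-monoʳ-≤ 2 (n≤2^⌈log2⌉n (suc ⌈ n /2⌉) (rs (⌈n/2⌉<n n))) ⟩
  2 * 2 ^ ⌈log2⌉ (suc ⌈ n /2⌉) (rs (⌈n/2⌉<n n)) ∎
  where open ≤-Reasoning

n≤2^⌈log₂n⌉ : ∀ n → n ≤ 2 ^ ⌈log₂ n ⌉
n≤2^⌈log₂n⌉ n = n≤2^⌈log2⌉n n (<-wellFounded n)

consistent⇒∈⋂ : ∀ {n} {e : Fin n} {Qs} → ConsistentWith e Qs → e ∈ ⋂ Qs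
consistent⇒∈⋂ []             = ∈⊤
consistent⇒∈⋂ (e∈Q ∷ e∈Qs) = x∈p∩q⁺ (e∈Q , consistent⇒∈⋂ e∈Qs)

candidates : ∀ {n} → View n → Subset n
candidates v = ⋂ (knownYes v)

asked : ∀ {n} → View n → ℕ
asked []            = 0
asked (nothing ∷ v) = suc (asked v)
asked (just _ ∷ v)  = asked v

Asked : (ℕ → ℕ) → ℕ → Pred ℕ 0ℓ
Asked position a i = ∃[ k ] k < a × position k ≡ i

Asked-suc : ∀ {position a i} → Asked position (suc a) i → Asked position a i ⊎ position a ≡ i
Asked-suc (k , k<1+a , eq) with m<1+n⇒m<n∨m≡n k<1+a
... | inj₁ k<a  = inj₁ (k , k<a , eq)
... | inj₂ refl = inj₂ eq

module Protocol {n m : ℕ} (code : Fin n → Subset m) where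

  column : ℕ → Subset n
  column i = tabulate (λ e → lookupℕ (code e) i)

  lookup-column : ∀ e x → lookup (column (toℕ x)) e ≡ lookup (code e) x
  lookup-column e x = trans (lookup∘tabulate _ e) (lookupℕ-toℕ (code e) x)

  ∈column⁺ : ∀ {e x} → x ∈ code e → e ∈ column (toℕ x)
  ∈column⁺ {e} {x} x∈ce = lookup⇒[]= e _ (trans (lookup-column e x) ([]=⇒lookup x∈ce))

  ∈column⁻ : ∀ {e x} → e ∈ column (toℕ x) → x ∈ code e
  ∈column⁻ {e} {x} e∈col = lookup⇒[]= x _ (trans (sym (lookup-column e x)) ([]=⇒lookup e∈col))

  downward : ℕ → ℕ
  downward k = m ∸ suc k

  scan : (ℕ → ℕ) → Strategy n
  scan position v = column (position (asked v)) ∩ candidates v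

  sB sC : Strategy n
  sB = scan id
  sC = scan downward

  all-asked : ∀ a c → a + c ≡ m → ∀ i → i < m → (Asked id a ∪ Asked downward c) i
  all-asked a c a+c≡m i i<m with i <? a
  ... | yes i<a = inj₁ (i , i<a , refl)
  ... | no  i≮a = inj₂ (m ∸ suc i , j<c , downward-involutive)
    where
    j<c : m ∸ suc i < c
    j<c = subst (m ∸ suc i <_) (trans (cong (_∸ a) (sym a+c≡m)) (m+n∸m≡n a c))
                (∸-monoʳ-< (s≤s (≮⇒≥ i≮a)) i<m)
    downward-involutive : m ∸ suc (m ∸ suc i) ≡ i
    downward-involutive = trans (sym (pred[m∸n]≡m∸[1+n] m (m ∸ suc i)))
                                (cong pred (m∸[m∸n]≡n i<m))

  module Run (d : Fin n) where

    Knows : Subset n → Pred ℕ 0ℓ → Set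
    Knows K P = ∀ i → P i → d ∈ column i → K ⊆ column i

    -- KB, KC are the candidate sets of B and C, PB, PC the positions each has asked.
    record Invariant (KB KC : Subset n) (PB PC : Pred ℕ 0ℓ) : Set where
      field
        d∈KB          : d ∈ KB
        d∈KC          : d ∈ KC
        C-knows-PB    : Knows KC PB
        B-knows-PC    : Knows KB PC
        one-knows-all : Knows KB (PB ∪ PC) ⊎ Knows KC (PB ∪ PC)
    open Invariant

    swap : ∀ {KB KC PB PC} → Invariant KB KC PB PC → Invariant KC KB PC PB
    swap I = record
      { d∈KB = d∈KC I ; d∈KC = d∈KB I
      ; C-knows-PB = B-knows-PC I ; B-knows-PC = C-knows-PB I
      ; one-knows-all = Sum.swap (Sum.map flip flip (one-knows-all I)) }
      where
      flip : ∀ {K PB PC} → Knows K (PB ∪ PC) → Knows K (PC ∪ PB)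
      flip k i p = k i (Sum.swap p)

    ask-yes : ∀ position a {KB KC PC} → Invariant KB KC (Asked position a) PC →
              d ∈ column (position a) ∩ KB →
              Invariant KB ((column (position a) ∩ KB) ∩ KC) (Asked position (suc a)) PC
    ask-yes position a {KB} {KC} {PC} I d∈Q = record
      { d∈KB = d∈KB I ; d∈KC = x∈p∩q⁺ (d∈Q , d∈KC I)
      ; C-knows-PB = knows-asked ; B-knows-PC = B-knows-PC I
      ; one-knows-all = inj₂ λ i → [ knows-asked i , knows-PC i ] }
      where
      Q : Subset n
      Q = column (position a) ∩ KB
      knows-asked : Knows (Q ∩ KC) (Asked position (suc a))
      knows-asked i asked-i d∈i with Asked-suc asked-i
      ... | inj₁ earlier = ⊆-trans (p∩q⊆q Q KC) (C-knows-PB I i earlier d∈i)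
      ... | inj₂ refl    = ⊆-trans (p∩q⊆p Q KC) (p∩q⊆p _ KB)
      knows-PC : Knows (Q ∩ KC) PC
      knows-PC i pc d∈i = ⊆-trans (p∩q⊆p Q KC) (⊆-trans (p∩q⊆q _ KB) (B-knows-PC I i pc d∈i))

    ask-no : ∀ position a {KB KC PC} → d ∉ column (position a) ∩ KB →
             Invariant KB KC (Asked position a) PC → Invariant KB KC (Asked position (suc a)) PC
    ask-no position a {PC = PC} d∉Q I = record
      { d∈KB = d∈KB I ; d∈KC = d∈KC I
      ; C-knows-PB = λ i p d∈i → C-knows-PB I i (earlier i p d∈i) d∈i
      ; B-knows-PC = B-knows-PC I
      ; one-knows-all = Sum.map restrict restrict (one-knows-all I) }
      where
      earlier : ∀ i → Asked position (suc a) i → d ∈ column i → Asked position a i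
      earlier i asked-i d∈i with Asked-suc asked-i
      ... | inj₁ asked-before = asked-before
      ... | inj₂ refl         = contradiction (x∈p∩q⁺ (d∈i , d∈KB I)) d∉Q
      restrict : ∀ {K} → Knows K (Asked position a ∪ PC) → Knows K (Asked position (suc a) ∪ PC)
      restrict k i p d∈i = k i (Sum.map₁ (λ q → earlier i q d∈i) p) d∈i

    StateInvariant : View n × View n → Set
    StateInvariant (vB , vC) =
      Invariant (candidates vB) (candidates vC) (Asked id (asked vB)) (Asked downward (asked vC))

    initial : StateInvariant ([] , [])
    initial = record
      { d∈KB = ∈⊤ ; d∈KC = ∈⊤
      ; C-knows-PB = λ _ () ; B-knows-PC = λ _ ()
      ; one-knows-all = inj₁ λ { _ (inj₁ ()) ; _ (inj₂ ()) } }

    step-preserves : ∀ st p → StateInvariant st → StateInvariant (step sB sC d st p)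
    step-preserves (vB , vC) B I with d ∈? sB vB
    ... | yes d∈Q = ask-yes id (asked vB) I d∈Q
    ... | no  d∉Q = ask-no id (asked vB) d∉Q I
    step-preserves (vB , vC) C I with d ∈? sC vC
    ... | yes d∈Q = swap (ask-yes downward (asked vC) (swap I) d∈Q)
    ... | no  d∉Q = swap (ask-no downward (asked vC) d∉Q (swap I))

    runFrom-preserves : ∀ {k} st (order : Vec Player k) →
                        StateInvariant st → StateInvariant (runFrom sB sC d st order)
    runFrom-preserves st []          I = I
    runFrom-preserves st (p ∷ order) I = runFrom-preserves _ order (step-preserves st p I)

    total : View n × View n → ℕ
    total (vB , vC) = asked vB + asked vC

    step-total : ∀ st p → total (step sB sC d st p) ≡ suc (total st)
    step-total (vB , vC) B with d ∈? sB vB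
    ... | yes _ = refl
    ... | no  _ = refl
    step-total (vB , vC) C with d ∈? sC vC
    ... | yes _ = +-suc (asked vB) (asked vC)
    ... | no  _ = +-suc (asked vB) (asked vC)

    runFrom-total : ∀ {k} st (order : Vec Player k) → total (runFrom sB sC d st order) ≡ k + total st
    runFrom-total st []                = refl
    runFrom-total st (_∷_ {k} p order) = begin
      total (runFrom sB sC d (step sB sC d st p) order) ≡⟨ runFrom-total _ order ⟩
      k + total (step sB sC d st p)                       ≡⟨ cong (k +_) (step-total st p) ⟩
      k + suc (total st)                                  ≡⟨ +-suc k (total st) ⟩
      suc k + total st                                    ∎
      where open ≡-Reasoning

    identifies : Antichain code → ∀ v → Knows (candidates v) (λ i → i < m) → Identifies d v
    identifies antichain v knows e e-consistent = sym (antichain d e d⊆e)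
      where
      d⊆e : code d ⊆ code e
      d⊆e {x} x∈d = ∈column⁻ (knows (toℕ x) (toℕ<n x) (∈column⁺ x∈d) (consistent⇒∈⋂ e-consistent))

  solves : Antichain code → Solves m sB sC
  solves antichain d order =
    Sum.map (identifies antichain vB ∘ everything) (identifies antichain vC ∘ everything)
            (Invariant.one-knows-all (runFrom-preserves ([] , []) order initial))
    where
    open Run d
    vB vC : View n
    vB = proj₁ (run sB sC d order)
    vC = proj₂ (run sB sC d order)
    everything : ∀ {K} → Knows K (Asked id (asked vB) ∪ Asked downward (asked vC)) →
                 Knows K (λ i → i < m)
    everything k i i<m =
      k i (all-asked _ _ (trans (runFrom-total ([] , []) order) (+-identityʳ m)) i i<m)

f4≤-antichain : ∀ {n m} (code : Fin n → Subset m) → Antichain code → f4≤ n m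
f4≤-antichain code antichain = sB , sC , solves antichain
  where open Protocol code

theorem4 : (n : ℕ) → 2 ≤ n → f4≤ n (bound4 n)
theorem4 n _ = subst (f4≤ n) (sym (+-assoc L c 2))
  (f4≤-antichain (withZeroCount K (binary L))
    (withZeroCount-antichain K (binary L) L<2^K (binary-injective L n≤2^L)))
  where
  L c K : ℕ
  L = ⌈log₂ n ⌉
  c = ⌈log₂ L ⌉
  K = c + 2
  n≤2^L : n ≤ 2 ^ L
  n≤2^L = n≤2^⌈log₂n⌉ n
  L<2^K : L < 2 ^ K
  L<2^K = ≤-<-trans (n≤2^⌈log₂n⌉ L) (^-monoʳ-< 2 (s≤s (s≤s z≤n)) (m<m+n c (s≤s z≤n)))
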